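{- Let $k_*\in\{1,2,\dots,\frac{\ell mn}{L}\}$ and write $k_*=(b-1)\lambda+c$ with $c\in\{1,2,\dots,\lambda\}$. If $(u_1,v_b,w_z)$ is a row of $A^{(k_*)}$ other than its first row, then $(u_1,v_b,w_z)\neq s_k$ for every $k\in\{1,2,\dots,\frac{\ell mn}{L}\}$.
   Context: Let $\ell,m,n\geq 2$ be integers, $L=\mathrm{lcm}(\ell,m,n)$ and $\lambda=\frac{n\cdot\mathrm{lcm}(\ell,m)}{L}$. Write $V(K_\ell)=\{u_1,\dots,u_\ell\}$, $V(K_m)=\{v_1,\dots,v_m\}$, $V(K_n)=\{w_1,\dots,w_n\}$, so vertices of $K_\ell\square K_m\square K_n$ are triples $(u_a,v_b,w_c)$. Let $\rho=(u_1\,u_2\,\cdots\,u_\ell)$, $\sigma=(v_1\,v_2\,\cdots\,v_m)$, $\tau=(w_1\,w_2\,\cdots\,w_n)$ be the cyclic permutations of the respective vertex sets. Define $L\times 3$ matrices $A^{(k)}=[\mathbf{c}^{(k)}\ \mathbf{d}^{(k)}\ \mathbf{e}^{(k)}]$ (columns) for $k=1,\dots,\frac{\ell mn}{L}$ as follows: row $r$ ($r=1,\dots,L$) of $A^{(1)}$ is $(\rho^{r-1}(u_1),\sigma^{r-1}(v_1),\tau^{r-1}(w_1))$; for $k>1$, $\mathbf{c}^{(k)}=\mathbf{c}^{(1)}$, and if $k\equiv 1\pmod{\lambda}$ then $\mathbf{d}^{(k)}=\sigma(\mathbf{d}^{(k-1)})$, $\mathbf{e}^{(k)}=\mathbf{e}^{(k-1)}$,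 while otherwise $\mathbf{d}^{(k)}=\mathbf{d}^{(k-1)}$, $\mathbf{e}^{(k)}=\tau(\mathbf{e}^{(k-1)})$ (permutations applied entrywise). Each row is regarded as a vertex of $K_\ell\square K_m\square K_n$. The seed $s_k$ is the first row of $A^{(k)}$. -}

module Defs where

open import Data.Nat using (ℕ; zero; suc; _+_; _*_; _∸_; _≡ᵇ_; NonZero)
open import Data.Nat.DivMod using (_/_)
open import Data.Nat.LCM using (lcm)
open import Data.Nat.Divisibility using (_∣?_)
open import Data.Bool using (if_then_else_)
open import Data.Product using (_×_; _,_)
open import Function using (_∘_)
open import Relation.Nullary using (does)

-- Vertex indices are 0-based: u_a ↔ a ∸ 1 (so u_1 ↔ 0), similarly for v, w.

cyc : ℕ → ℕ → ℕ
cyc p a = if suc a ≡ᵇ p then 0 else suc a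

iter : (ℕ → ℕ) → ℕ → ℕ → ℕ
iter f zero    x = x
iter f (suc i) x = f (iter f i x)

-- division that is only ever used with a nonzero divisor (L ≠ 0 since ℓ,m,n ≥ 2)
divN : ℕ → ℕ → ℕ
divN a zero    = 0
divN a (suc d) = a / suc d

Lcm3 : ℕ → ℕ → ℕ → ℕ
Lcm3 ℓ m n = lcm (lcm ℓ m) n

lam : ℕ → ℕ → ℕ → ℕ
lam ℓ m n = divN (n * lcm ℓ m) (Lcm3 ℓ m n)

numMat : ℕ → ℕ → ℕ → ℕ
numMat ℓ m n = divN (ℓ * m * n) (Lcm3 ℓ m n)

Vertex : Set
Vertex = ℕ × ℕ × ℕ

-- a column, indexed by the row number r ∈ {1,…,L}
Col : Set
Col = ℕ → ℕ

A1 : ℕ → ℕ → ℕ → Col × Col × Col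
A1 ℓ m n = (λ r → iter (cyc ℓ) (r ∸ 1) 0)
         , (λ r → iter (cyc m) (r ∸ 1) 0)
         , (λ r → iter (cyc n) (r ∸ 1) 0)

-- A^(k) for k ≥ 1 (the value at k = 0 is an irrelevant dummy)
A : ℕ → ℕ → ℕ → ℕ → Col × Col × Col
A ℓ m n zero = A1 ℓ m n
A ℓ m n (suc zero) = A1 ℓ m n
A ℓ m n (suc (suc j)) with A ℓ m n (suc j) | A1 ℓ m n
... | (_ , d , e) | (c₁ , _ , _) =
  if does (lam ℓ m n ∣? (suc (suc j) ∸ 1))
  then (c₁ , cyc m ∘ d , e)
  else (c₁ , d , cyc n ∘ e)

row : ℕ → ℕ → ℕ → ℕ → ℕ → Vertex
row ℓ m n k r with A ℓ m n k
... | (c , d , e) = (c r , d r , e r)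

seed : ℕ → ℕ → ℕ → ℕ → Vertex
seed ℓ m n k = row ℓ m n k 1

module Submission where

-- A^(j+1) is A^(1) with its second column moved on by σ-steps j = ⌊j/λ⌋ and its third by
-- τ-steps j = j − ⌊j/λ⌋, so its row R+1 is (R mod ℓ, (σ-steps j + R) mod m, (τ-steps j + R) mod n).
-- If row R+1 of A^(k*) (with 0 < R < L) is the seed of A^(j+1), the first two coordinates give
-- lcm(ℓ,m) ∣ R and equal σ-counts, and then the third gives
-- ((k*−1) mod λ) + R ≡ j mod λ (mod n). As λ divides both n and lcm(ℓ,m), reducing mod λ makes
-- the two residues equal, hence n ∣ R too, so L ∣ R: impossible.

open import Defs
open import Data.Nat
open import Data.Nat.Properties
open import Data.Nat.DivMod
open import Data.Nat.Divisibility
open import Data.Nat.LCM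
open import Data.Nat.GCD using (gcd)
open import Data.Bool using (T; true; false; if_then_else_)
open import Data.Product using (_,_)
open import Data.Product.Properties using (,-injective; ,-injectiveˡ; ,-injectiveʳ)
open import Relation.Nullary using (does; yes; no; ¬_; contradiction)
open import Relation.Binary.PropositionalEquality

iter-+ : ∀ f a b x → iter f (a + b) x ≡ iter f a (iter f b x)
iter-+ f zero    b x = refl
iter-+ f (suc a) b x = cong f (iter-+ f a b x)

cyc≡suc% : ∀ p .{{_ : NonZero p}} {a} → a < p → cyc p a ≡ suc a % p
cyc≡suc% p {a} a<p with suc a ≡ᵇ p in eq
... | true  rewrite ≡ᵇ⇒≡ (suc a) p (subst T (sym eq) _) = sym (n%n≡0 p)
... | false = sym (m<n⇒m%n≡m (≤∧≢⇒< a<p λ a+1≡p → subst T eq (≡⇒≡ᵇ (suc a) p a+1≡p)))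

iter-cyc : ∀ p .{{_ : NonZero p}} i → iter (cyc p) i 0 ≡ i % p
iter-cyc p zero    = sym (m*n%n≡0 0 p)
iter-cyc p (suc i) = begin
  cyc p (iter (cyc p) i 0)  ≡⟨ cong (cyc p) (iter-cyc p i) ⟩
  cyc p (i % p)             ≡⟨ cyc≡suc% p (m%n<n i p) ⟩
  (1 + i % p) % p           ≡⟨ %-distribˡ-+ 1 (i % p) p ⟩
  (1 % p + i % p % p) % p   ≡⟨ cong (λ t → (1 % p + t) % p) (m%n%n≡m%n i p) ⟩
  (1 % p + i % p) % p       ≡⟨ %-distribˡ-+ 1 i p ⟨
  suc i % p                 ∎
  where open ≡-Reasoning

iter-cyc-+ : ∀ p .{{_ : NonZero p}} a b → iter (cyc p) a (iter (cyc p) b 0) ≡ (a + b) % p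
iter-cyc-+ p a b = trans (sym (iter-+ (cyc p) a b 0)) (iter-cyc p (a + b))

%-+-congˡ : ∀ x {a b n} .{{_ : NonZero n}} → a % n ≡ b % n → (x + a) % n ≡ (x + b) % n
%-+-congˡ x {a} {b} {n} a≡b = begin
  (x + a) % n           ≡⟨ %-distribˡ-+ x a n ⟩
  (x % n + a % n) % n   ≡⟨ cong (λ t → (x % n + t) % n) a≡b ⟩
  (x % n + b % n) % n   ≡⟨ %-distribˡ-+ x b n ⟨
  (x + b) % n           ∎
  where open ≡-Reasoning

%-+-cancelˡ : ∀ x {a b n} .{{_ : NonZero n}} → (x + a) % n ≡ (x + b) % n → a % n ≡ b % n
%-+-cancelˡ x {a} {b} {n} x+a≡x+b = begin
  a % n               ≡⟨ %-remove-+ˡ a n∣y+x ⟨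
  (y + x + a) % n     ≡⟨ cong (_% n) (+-assoc y x a) ⟩
  (y + (x + a)) % n   ≡⟨ %-+-congˡ y x+a≡x+b ⟩
  (y + (x + b)) % n   ≡⟨ cong (_% n) (+-assoc y x b) ⟨
  (y + x + b) % n     ≡⟨ %-remove-+ˡ b n∣y+x ⟩
  b % n               ∎
  where
    open ≡-Reasoning
    y = n ∸ x % n
    n∣y+x : n ∣ y + x
    n∣y+x = subst (n ∣_) (begin
      n + x / n * n                   ≡⟨ cong (_+ x / n * n) (m∸n+n≡m (m%n≤n x n)) ⟨
      y + x % n + x / n * n           ≡⟨ +-assoc y (x % n) _ ⟩
      y + (x % n + x / n * n)         ≡⟨ cong (y +_) (m≡m%n+[m/n]*n x n) ⟨
      y + x                           ∎) (∣m∣n⇒∣m+n ∣-refl (n∣m*n (x / n)))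

[x+a]%n≡x⇒n∣a : ∀ {x a n} .{{_ : NonZero n}} → (x + a) % n ≡ x → n ∣ a
[x+a]%n≡x⇒n∣a {x} {a} {n} x+a≡x = m%n≡0⇒n∣m a n (trans (%-+-cancelˡ x (begin
  (x + a) % n   ≡⟨ x+a≡x ⟩
  x             ≡⟨ m<n⇒m%n≡m x<n ⟨
  x % n         ≡⟨ cong (_% n) (+-identityʳ x) ⟨
  (x + 0) % n   ∎)) (m*n%n≡0 0 n))
  where
    open ≡-Reasoning
    x<n : x < n
    x<n = subst (_< n) x+a≡x (m%n<n (x + a) n)

[c+a]%n≡s%n⇒n∣a : ∀ {g n a c s} .{{_ : NonZero g}} .{{_ : NonZero n}} →
  g ∣ n → g ∣ a → c < g → s < g → (c + a) % n ≡ s % n → n ∣ a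
[c+a]%n≡s%n⇒n∣a {g} {n} {a} {c} {s} g∣n g∣a c<g s<g c+a≡s =
  m%n≡0⇒n∣m a n (trans (%-+-cancelˡ c (begin
    (c + a) % n   ≡⟨ c+a≡s ⟩
    s % n         ≡⟨ cong (_% n) (trans (sym c≡s) (sym (+-identityʳ c))) ⟩
    (c + 0) % n   ∎)) (m*n%n≡0 0 n))
  where
    open ≡-Reasoning
    c≡s : c ≡ s
    c≡s = begin
      c             ≡⟨ m<n⇒m%n≡m c<g ⟨
      c % g         ≡⟨ %-remove-+ʳ c g∣a ⟨
      (c + a) % g   ≡⟨ m∣n⇒o%n%m≡o%m g n (c + a) g∣n ⟨
      (c + a) % n % g ≡⟨ cong (_% g) c+a≡s ⟩
      s % n % g     ≡⟨ m∣n⇒o%n%m≡o%m g n s g∣n ⟩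
      s % g         ≡⟨ m<n⇒m%n≡m s<g ⟩
      s             ∎

m*n≡o*p⇒p∣n⇒m∣o : ∀ {m n o p} .{{_ : NonZero p}} → m * n ≡ o * p → p ∣ n → m ∣ o
m*n≡o*p⇒p∣n⇒m∣o {m} {n} {o} {p} mn≡op (divides t n≡tp) =
  divides t (*-cancelʳ-≡ o (t * m) p (begin
    o * p         ≡⟨ mn≡op ⟨
    m * n         ≡⟨ cong (m *_) n≡tp ⟩
    m * (t * p)   ≡⟨ *-assoc m t p ⟨
    m * t * p     ≡⟨ cong (_* p) (*-comm m t) ⟩
    t * m * p     ∎))
  where open ≡-Reasoning

lcm-nonZero : ∀ a b .{{_ : NonZero a}} .{{_ : NonZero b}} → NonZero (lcm a b)
lcm-nonZero a b = ≢-nonZero λ lcm≡0 → ≢-nonZero⁻¹ (a * b) {{m*n≢0 a b}} (begin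
  a * b               ≡⟨ gcd*lcm a b ⟨
  gcd a b * lcm a b   ≡⟨ cong (gcd a b *_) lcm≡0 ⟩
  gcd a b * 0         ≡⟨ *-zeroʳ (gcd a b) ⟩
  0                   ∎)
  where open ≡-Reasoning

module StepCounts (g : ℕ) where

  σ-steps : ℕ → ℕ
  σ-steps zero    = 0
  σ-steps (suc j) = if does (g ∣? suc j) then suc (σ-steps j) else σ-steps j

  τ-steps : ℕ → ℕ
  τ-steps zero    = 0
  τ-steps (suc j) = if does (g ∣? suc j) then τ-steps j else suc (τ-steps j)

  σ-steps+τ-steps : ∀ j → σ-steps j + τ-steps j ≡ j
  σ-steps+τ-steps zero = refl
  σ-steps+τ-steps (suc j) with g ∣? suc j
  ... | yes _ = cong suc (σ-steps+τ-steps j)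
  ... | no _  = trans (+-suc (σ-steps j) (τ-steps j)) (cong suc (σ-steps+τ-steps j))

  σ-steps-∣ : ∀ {j} → g ∣ suc j → σ-steps (suc j) ≡ suc (σ-steps j)
  σ-steps-∣ {j} g∣j+1 with g ∣? suc j
  ... | yes _  = refl
  ... | no g∤j+1 = contradiction g∣j+1 g∤j+1

  σ-steps-∤ : ∀ {j} → ¬ g ∣ suc j → σ-steps (suc j) ≡ σ-steps j
  σ-steps-∤ {j} g∤j+1 with g ∣? suc j
  ... | yes g∣j+1 = contradiction g∣j+1 g∤j+1
  ... | no _      = refl

  module _ .{{_ : NonZero g}} where

    σ-steps[q*g+s]≡q : ∀ q {s} → s < g → σ-steps (q * g + s) ≡ q
    σ-steps[q*g+s]≡q zero    {zero}  _   = refl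
    σ-steps[q*g+s]≡q (suc q) {zero}  _   = begin
      σ-steps (suc q * g + 0)           ≡⟨ cong σ-steps last-before ⟩
      σ-steps (suc (q * g + pred g))    ≡⟨ σ-steps-∣ (subst (g ∣_) last-before (divides (suc q) (+-identityʳ _))) ⟩
      suc (σ-steps (q * g + pred g))    ≡⟨ cong suc (σ-steps[q*g+s]≡q q (≤-reflexive (suc-pred g))) ⟩
      suc q                             ∎
      where
        open ≡-Reasoning
        last-before : suc q * g + 0 ≡ suc (q * g + pred g)
        last-before = begin
          suc q * g + 0         ≡⟨ +-identityʳ (suc q * g) ⟩
          g + q * g             ≡⟨ +-comm g (q * g) ⟩
          q * g + g             ≡⟨ cong (q * g +_) (suc-pred g) ⟨
          q * g + suc (pred g)  ≡⟨ +-suc (q * g) (pred g) ⟩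
          suc (q * g + pred g)  ∎
    σ-steps[q*g+s]≡q q       {suc s} s+1<g = begin
      σ-steps (q * g + suc s)     ≡⟨ cong σ-steps (+-suc (q * g) s) ⟩
      σ-steps (suc (q * g + s))   ≡⟨ σ-steps-∤ g∤ ⟩
      σ-steps (q * g + s)         ≡⟨ σ-steps[q*g+s]≡q q (<-trans (n<1+n s) s+1<g) ⟩
      q                           ∎
      where
        open ≡-Reasoning
        g∤ : ¬ g ∣ suc (q * g + s)
        g∤ g∣ = >⇒∤ s+1<g (∣m+n∣m⇒∣n (subst (g ∣_) (sym (+-suc (q * g) s)) g∣) (n∣m*n q))

    σ-steps≡/ : ∀ j → σ-steps j ≡ j / g
    σ-steps≡/ j = begin
      σ-steps j                    ≡⟨ cong σ-steps (trans (m≡m%n+[m/n]*n j g) (+-comm (j % g) _)) ⟩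
      σ-steps (j / g * g + j % g)  ≡⟨ σ-steps[q*g+s]≡q (j / g) (m%n<n j g) ⟩
      j / g                        ∎
      where open ≡-Reasoning

    j≡σ-steps*g+j%g : ∀ j → j ≡ σ-steps j * g + j % g
    j≡σ-steps*g+j%g j = trans (m≡m%n+[m/n]*n j g) (trans (+-comm (j % g) _) (cong (λ q → q * g + j % g) (sym (σ-steps≡/ j))))

    τ-steps-shift : ∀ {i j a n} .{{_ : NonZero n}} → σ-steps i ≡ σ-steps j →
      (τ-steps i + a) % n ≡ τ-steps j % n → (i % g + a) % n ≡ j % g % n
    τ-steps-shift {i} {j} {a} {n} σi≡σj τi+a≡τj = %-+-cancelˡ (σ-steps j * g) (begin
      (σ-steps j * g + (i % g + a)) % n  ≡⟨ cong (λ q → (q * g + (i % g + a)) % n) σi≡σj ⟨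
      (σ-steps i * g + (i % g + a)) % n  ≡⟨ cong (_% n) (+-assoc _ (i % g) a) ⟨
      (σ-steps i * g + i % g + a) % n    ≡⟨ cong (λ t → (t + a) % n) (j≡σ-steps*g+j%g i) ⟨
      (i + a) % n                        ≡⟨ cong (λ t → (t + a) % n) (σ-steps+τ-steps i) ⟨
      (σ-steps i + τ-steps i + a) % n    ≡⟨ cong (_% n) (+-assoc (σ-steps i) _ a) ⟩
      (σ-steps i + (τ-steps i + a)) % n  ≡⟨ %-+-congˡ (σ-steps i) (trans τi+a≡τj (sym (m%n%n≡m%n _ n))) ⟩
      (σ-steps i + τ-steps j % n) % n    ≡⟨ %-+-congˡ (σ-steps i) (m%n%n≡m%n _ n) ⟩
      (σ-steps i + τ-steps j) % n        ≡⟨ cong (λ t → (t + τ-steps j) % n) σi≡σj ⟩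
      (σ-steps j + τ-steps j) % n        ≡⟨ cong (_% n) (σ-steps+τ-steps j) ⟩
      j % n                              ≡⟨ cong (_% n) (j≡σ-steps*g+j%g j) ⟩
      (σ-steps j * g + j % g) % n        ∎)
      where open ≡-Reasoning

module Rows (ℓ m n : ℕ) where
  open StepCounts (lam ℓ m n)

  row-suc-iter : ∀ j r → row ℓ m n (suc j) r ≡
    ( iter (cyc ℓ) (r ∸ 1) 0
    , iter (cyc m) (σ-steps j) (iter (cyc m) (r ∸ 1) 0)
    , iter (cyc n) (τ-steps j) (iter (cyc n) (r ∸ 1) 0))
  row-suc-iter zero    r = refl
  row-suc-iter (suc j) r with lam ℓ m n ∣? suc j | ,-injective (,-injectiveʳ (row-suc-iter j r))
  ... | yes _ | σ≡ , τ≡ = cong₂ (λ x y → _ , x , y) (cong (cyc m) σ≡) τ≡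
  ... | no _  | σ≡ , τ≡ = cong₂ (λ x y → _ , x , y) σ≡ (cong (cyc n) τ≡)

divN≡/ : ∀ a d .{{_ : NonZero d}} → divN a d ≡ a / d
divN≡/ a (suc d) = refl

module Matrices (ℓ m n : ℕ) .{{_ : NonZero ℓ}} .{{_ : NonZero m}} .{{_ : NonZero n}} where
  open StepCounts (lam ℓ m n)
  open Rows ℓ m n

  instance
    lcm-ℓ-m-nonZero : NonZero (lcm ℓ m)
    lcm-ℓ-m-nonZero = lcm-nonZero ℓ m
    Lcm3-nonZero : NonZero (Lcm3 ℓ m n)
    Lcm3-nonZero = lcm-nonZero (lcm ℓ m) n

  lam*L≡n*lcm : lam ℓ m n * Lcm3 ℓ m n ≡ n * lcm ℓ m
  lam*L≡n*lcm = trans (cong (_* Lcm3 ℓ m n) (divN≡/ (n * lcm ℓ m) (Lcm3 ℓ m n)))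
                      (m/n*n≡m (lcm-least (n∣m*n n) (m∣m*n (lcm ℓ m))))

  instance
    lam-nonZero : NonZero (lam ℓ m n)
    lam-nonZero = ≢-nonZero λ lam≡0 → ≢-nonZero⁻¹ (n * lcm ℓ m) {{m*n≢0 n (lcm ℓ m)}}
      (trans (sym lam*L≡n*lcm) (cong (_* Lcm3 ℓ m n) lam≡0))

  lam∣n : lam ℓ m n ∣ n
  lam∣n = m*n≡o*p⇒p∣n⇒m∣o lam*L≡n*lcm (m∣lcm[m,n] (lcm ℓ m) n)

  lam∣lcm : lam ℓ m n ∣ lcm ℓ m
  lam∣lcm = m*n≡o*p⇒p∣n⇒m∣o (trans lam*L≡n*lcm (*-comm n _)) (n∣lcm[m,n] (lcm ℓ m) n)

  numMat≤m*lam : numMat ℓ m n ≤ m * lam ℓ m n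
  numMat≤m*lam = *-cancelʳ-≤ (numMat ℓ m n) (m * lam ℓ m n) L (begin
    numMat ℓ m n * L          ≡⟨ cong (_* L) (divN≡/ (ℓ * m * n) L) ⟩
    ℓ * m * n / L * L         ≤⟨ m/n*n≤m (ℓ * m * n) L ⟩
    ℓ * m * n                 ≤⟨ *-monoˡ-≤ n (*-monoˡ-≤ m (∣⇒≤ (m∣lcm[m,n] ℓ m))) ⟩
    lcm ℓ m * m * n           ≡⟨ cong (_* n) (*-comm (lcm ℓ m) m) ⟩
    m * lcm ℓ m * n           ≡⟨ *-assoc m (lcm ℓ m) n ⟩
    m * (lcm ℓ m * n)         ≡⟨ cong (m *_) (*-comm (lcm ℓ m) n) ⟩
    m * (n * lcm ℓ m)         ≡⟨ cong (m *_) lam*L≡n*lcm ⟨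
    m * (lam ℓ m n * L)       ≡⟨ *-assoc m (lam ℓ m n) L ⟨
    m * lam ℓ m n * L         ∎)
    where
      open ≤-Reasoning
      L = Lcm3 ℓ m n

  σ-steps<m : ∀ {j} → suc j ≤ numMat ℓ m n → σ-steps j < m
  σ-steps<m {j} j<numMat = subst (_< m) (sym (σ-steps≡/ j)) (m<n*o⇒m/o<n (≤-trans j<numMat numMat≤m*lam))

  row-suc : ∀ j R → row ℓ m n (suc j) (suc R) ≡ (R % ℓ , (σ-steps j + R) % m , (τ-steps j + R) % n)
  row-suc j R = trans (row-suc-iter j (suc R))
    (cong₂ _,_ (iter-cyc ℓ R) (cong₂ _,_ (iter-cyc-+ m (σ-steps j) R) (iter-cyc-+ n (τ-steps j) R)))

  seed-suc : ∀ j → seed ℓ m n (suc j) ≡ (0 , σ-steps j % m , τ-steps j % n)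
  seed-suc j = trans (row-suc j 0)
    (cong₂ _,_ (m*n%n≡0 0 ℓ) (cong₂ _,_ (cong (_% m) (+-identityʳ _)) (cong (_% n) (+-identityʳ _))))

mainTheorem6 : (ℓ m n : ℕ) → 2 ≤ ℓ → 2 ≤ m → 2 ≤ n →
    (kstar b c : ℕ) → 1 ≤ kstar → kstar ≤ numMat ℓ m n →
    1 ≤ b → 1 ≤ c → c ≤ lam ℓ m n → kstar ≡ (b ∸ 1) * lam ℓ m n + c →
    (z : ℕ) → 1 ≤ z → z ≤ n →
    (r : ℕ) → 2 ≤ r → r ≤ Lcm3 ℓ m n →
    row ℓ m n kstar r ≡ (0 , b ∸ 1 , z ∸ 1) →
    (k : ℕ) → 1 ≤ k → k ≤ numMat ℓ m n →
    seed ℓ m n k ≢ (0 , b ∸ 1 , z ∸ 1)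
mainTheorem6 ℓ@(suc _) m@(suc _) n@(suc _) _ _ _ (suc j*) b (suc c′) _ _ _ _ c′<g k*≡ z _ _
             (suc R) 2≤r R<L row≡ (suc j) _ k≤N seed≡ =
  <⇒≱ R<L (∣⇒≤ {{>-nonZero (s≤s⁻¹ 2≤r)}} (lcm-least lcm∣R n∣R))
  where
    open Matrices ℓ m n
    open StepCounts (lam ℓ m n)
    at-row : (R % ℓ , (σ-steps j* + R) % m , (τ-steps j* + R) % n) ≡ (0 , b ∸ 1 , z ∸ 1)
    at-row = trans (sym (row-suc j* R)) row≡
    at-seed : (0 , σ-steps j % m , τ-steps j % n) ≡ (0 , b ∸ 1 , z ∸ 1)
    at-seed = trans (sym (seed-suc j)) seed≡
    σj*≡b-1 : σ-steps j* ≡ b ∸ 1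
    σj*≡b-1 = trans (cong σ-steps (suc-injective (trans k*≡ (+-suc _ c′)))) (σ-steps[q*g+s]≡q (b ∸ 1) c′<g)
    σj≡b-1 : σ-steps j ≡ b ∸ 1
    σj≡b-1 = trans (sym (m<n⇒m%n≡m (σ-steps<m k≤N))) (,-injectiveˡ (,-injectiveʳ at-seed))
    lcm∣R : lcm ℓ m ∣ R
    lcm∣R = lcm-least (m%n≡0⇒n∣m R ℓ (,-injectiveˡ at-row))
      ([x+a]%n≡x⇒n∣a (subst (λ t → (t + R) % m ≡ b ∸ 1) σj*≡b-1 (,-injectiveˡ (,-injectiveʳ at-row))))
    n∣R : n ∣ R
    n∣R = [c+a]%n≡s%n⇒n∣a lam∣n (∣-trans lam∣lcm lcm∣R) (m%n<n j* _) (m%n<n j _)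
      (τ-steps-shift (trans σj*≡b-1 (sym σj≡b-1))
        (trans (,-injectiveʳ (,-injectiveʳ at-row)) (sym (,-injectiveʳ (,-injectiveʳ at-seed)))))
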